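{- Let $\beta_\gamma=(\{a,b,c\},\{a\#b,\ b\#a\},\{\{a,b\}\mapsto c\})$. There is no growing-causality event structure (GES) $\gamma$ with $C(\gamma)=C(\beta_\gamma)$.
   Context: $\beta_\gamma$ is a bundle event structure $(E,\#,\mapsto)$ with conflict $\#$ (irreflexive, symmetric) and bundle $\{a,b\}\mapsto c$. A trace of such a structure is a finite sequence $e_1\cdots e_n$ of pairwise distinct events with $\neg(e_i\#e_j)$ for all $i,j$ and $X\cap\{e_1,\dots,e_{i-1}\}\neq\emptyset$ for every $i$ and every bundle $X\mapsto e_i$; $C(\beta_\gamma)$ is the set of event sets of its traces. A GES is a tuple $\gamma=(E,\#,\to,\lhd)$ with $E$ a set of events, $\#\subseteq E\times E$ irreflexive and symmetric, $\to\ \subseteq E\times E$ (initial causality), and $\lhd\subseteq E^3$; write $m\lhd[c\to t]$ for $(c,m,t)\in\lhd$ (the occurrence of $m$ adds $c$ as a cause of $t$), required to imply $\neg(c\to t)$. Let $ic(e)=\{e'\mid e'\to e\}$ and $ac(H,e)=\{e'\mid\exists a\in H.\ a\lhd[e'\to e]\}$. For $X,Y\subseteq E$, $X\to_g Y$ iff $X\subseteq Y$, $\neg(e\#e')$ for all $e,e'\in Y$, $ic(e)\cup ac(X,e)\subseteq X$ for all $e\in Y\setminus X$, and for all $t,m\in Y\setminus X$ and $c\in E$, $m\lhd[c\to t]$ implies $c\in X$. $C(\gamma)$ is the set of subsets of $E$ reachable from $\emptyset$ by finitely many $\to_g$-steps. -}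

module Defs where

open import Level using (0ℓ)
open import Data.Empty using (⊥)
open import Data.Product using (Σ; ∃; _×_; _,_)
open import Data.Sum using (_⊎_)
open import Data.List using (List; []; _∷_)
open import Data.List.Membership.Propositional using (_∈_; _∉_)
open import Relation.Nullary using (¬_)
open import Relation.Unary using (Pred; _⊆_; _∪_)
open import Relation.Binary.PropositionalEquality using (_≡_)

_≐_ : {E : Set} → Pred E 0ℓ → Pred E 0ℓ → Set
X ≐ Y = (X ⊆ Y) × (Y ⊆ X)

record BES : Set₁ where
  field
    E      : Set
    _#_    : E → E → Set
    #-irr  : ∀ e → ¬ (e # e)
    #-sym  : ∀ {e e'} → e # e' → e' # e
    _↦_    : Pred E 0ℓ → E → Set

module _ (β : BES) where
  open BES β

  -- A trace e₁ ⋯ eₙ is represented in REVERSE order as a list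
  -- eₙ ∷ ⋯ ∷ e₁ ∷ [] ; extending a trace by a new last event e
  -- is consing e.  IsTrace t holds iff the sequence is a trace.
  data IsTrace : List E → Set₁ where
    tr-[] : IsTrace []
    tr-∷  : ∀ {e t} → IsTrace t
          → e ∉ t
          → ¬ (e # e)
          → (∀ {e'} → e' ∈ t → ¬ (e # e') × ¬ (e' # e))
          → (∀ {X} → X ↦ e → ∃ λ x → X x × x ∈ t)
          → IsTrace (e ∷ t)

  Conf : Pred E 0ℓ → Set₁
  Conf X = ∃ λ t → IsTrace t × (X ≐ (λ e → e ∈ t))

data Ev : Set where
  a b c : Ev

data _#β_ : Ev → Ev → Set where
  ab : a #β b
  ba : b #β a

#β-irr : ∀ e → ¬ (e #β e)
#β-irr a ()
#β-irr b ()
#β-irr c ()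

#β-sym : ∀ {e e'} → e #β e' → e' #β e
#β-sym ab = ba
#β-sym ba = ab

AB : Pred Ev 0ℓ
AB e = (e ≡ a) ⊎ (e ≡ b)

_↦β_ : Pred Ev 0ℓ → Ev → Set
X ↦β e = (X ≐ AB) × (e ≡ c)

βγ : BES
βγ = record { E = Ev ; _#_ = _#β_ ; #-irr = #β-irr ; #-sym = #β-sym ; _↦_ = _↦β_ }

record GES (E : Set) : Set₁ where
  field
    _#_   : E → E → Set
    #-irr : ∀ e → ¬ (e # e)
    #-sym : ∀ {e e'} → e # e' → e' # e
    _⟶_   : E → E → Set
    ⊲     : E → E → E → Set             -- ⊲ c m t  means  m ⊲ [c → t]
    ⊲-ok  : ∀ {c m t} → ⊲ c m t → ¬ (c ⟶ t)

module _ {E : Set} (γ : GES E) where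
  open GES γ

  ic : E → Pred E 0ℓ
  ic e e' = e' ⟶ e

  ac : Pred E 0ℓ → E → Pred E 0ℓ
  ac H e e' = ∃ λ m → H m × ⊲ e' m e

  Step : Pred E 0ℓ → Pred E 0ℓ → Set
  Step X Y =
      (X ⊆ Y)
    × (∀ {e e'} → Y e → Y e' → ¬ (e # e'))
    × (∀ {e} → Y e → ¬ X e → (ic e ∪ ac X e) ⊆ X)
    × (∀ {t m c} → Y t → ¬ X t → Y m → ¬ X m → ⊲ c m t → X c)

  data Reach : Pred E 0ℓ → Set₁ where
    r-∅    : ∀ {X} → (∀ e → ¬ X e) → Reach X
    r-step : ∀ {X Y} → Reach X → Step X Y → Reach Y

{-# OPTIONS --safe #-}
module Submission where

-- Both {a,c} and {b,c} are configurations of βγ. In a GES, an initial cause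
-- of c, or a cause that c adds to itself, must already be present in any
-- configuration at the step where c occurs; so it would have to be a in the
-- first configuration and b in the second. Hence c has no such causes, and
-- {c} is reachable in a single step from ∅, whereas in βγ the bundle
-- {a,b} ↦ c forbids c from occurring first.

open import Level using (0ℓ)
open import Data.Empty using (⊥; ⊥-elim)
open import Data.Product using (Σ; ∃; _×_; _,_; proj₁; proj₂)
open import Data.Sum using (_⊎_; inj₁; inj₂)
open import Data.List using ([]; _∷_)
open import Data.List.Membership.Propositional using (_∈_)
open import Data.List.Relation.Unary.Any using (here; there)
open import Function using (id)
open import Relation.Nullary using (¬_)
open import Relation.Nullary.Negation using (¬¬-map)
open import Relation.Unary using (Pred)
open import Relation.Binary.PropositionalEquality using (_≡_; _≢_; refl; sym; trans; subst)
open import Defs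

module _ (β : BES) where
  open BES β

  trace-satisfies-bundle : ∀ {t e X} → IsTrace β t → e ∈ t → X ↦ e → ∃ λ x → X x × x ∈ t
  trace-satisfies-bundle (tr-∷ _ _ _ _ bundles) (here refl) X↦e with bundles X↦e
  ... | x , Xx , x∈t = x , Xx , there x∈t
  trace-satisfies-bundle (tr-∷ t _ _ _ _) (there e∈t) X↦e with trace-satisfies-bundle t e∈t X↦e
  ... | x , Xx , x∈t = x , Xx , there x∈t

module _ {E : Set} (γ : GES E) where
  open GES γ

  NecessaryCause : E → Pred E 0ℓ
  NecessaryCause e y = (y ⟶ e) ⊎ ⊲ y e e

  -- Double negation because whether the event was already in the
  -- configuration before the last step is not decidable.
  necessaryCause-precedes : ∀ {Y e y} → Reach γ Y → Y e → NecessaryCause e y →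
                            ¬ ¬ (Y y × y ≢ e)
  necessaryCause-precedes (r-∅ empty) Ye _ _ = empty _ Ye
  necessaryCause-precedes {e = e} {y} (r-step {X} r (X⊆Y , _ , causes⊆X , modifiers⊆X)) Ye cause ¬goal =
    ¬goal (X⊆Y Xy , λ y≡e → ¬Xe (subst X y≡e Xy))
    where
    ¬Xe : ¬ X e
    ¬Xe Xe = necessaryCause-precedes r Xe cause (λ (Xy , y≢e) → ¬goal (X⊆Y Xy , y≢e))
    present : NecessaryCause e y → X y
    present (inj₁ y⟶e)     = causes⊆X Ye ¬Xe (inj₁ y⟶e)
    present (inj₂ e⊲[y→e]) = modifiers⊆X Ye ¬Xe Ye ¬Xe e⊲[y→e]
    Xy : X y
    Xy = present cause

  singleton-reachable : ∀ {e} → (∀ y → ¬ NecessaryCause e y) → Reach γ (_≡ e)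
  singleton-reachable {e} uncaused =
    r-step (r-∅ λ _ ()) ((λ ()) , conflict-free , causes⊆∅ , modifiers⊆∅)
    where
    conflict-free : ∀ {x x'} → x ≡ e → x' ≡ e → ¬ (x # x')
    conflict-free refl refl = #-irr e
    causes⊆∅ : ∀ {x} → x ≡ e → ¬ ⊥ → ∀ {y} → (ic γ x y ⊎ ac γ (λ _ → ⊥) x y) → ⊥
    causes⊆∅ refl _ (inj₁ y⟶e) = uncaused _ (inj₁ y⟶e)
    causes⊆∅ refl _ (inj₂ (_ , () , _))
    modifiers⊆∅ : ∀ {t m y} → t ≡ e → ¬ ⊥ → m ≡ e → ¬ ⊥ → ⊲ y m t → ⊥
    modifiers⊆∅ refl _ refl _ e⊲[y→e] = uncaused _ (inj₂ e⊲[y→e])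

PairC : Ev → Pred Ev 0ℓ
PairC x e = (e ≡ x) ⊎ (e ≡ c)

pairC-≢c : ∀ {x y} → PairC x y → y ≢ c → y ≡ x
pairC-≢c (inj₁ y≡x) _   = y≡x
pairC-≢c (inj₂ y≡c) y≢c = ⊥-elim (y≢c y≡c)

pairC-conf : ∀ {x} → AB x → Conf βγ (PairC x)
pairC-conf {x} ABx = (c ∷ x ∷ []) , trace , (⊆trace , trace⊆)
  where
  ¬c#x : AB x → ¬ (c #β x)
  ¬c#x (inj₁ refl) ()
  ¬c#x (inj₂ refl) ()
  ¬x#c : AB x → ¬ (x #β c)
  ¬x#c (inj₁ refl) ()
  ¬x#c (inj₂ refl) ()
  x≢c : AB x → x ≢ c
  x≢c (inj₁ refl) ()
  x≢c (inj₂ refl) ()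
  trace : IsTrace βγ (c ∷ x ∷ [])
  trace = tr-∷ (tr-∷ tr-[] (λ ()) (#β-irr x) (λ ()) (λ (_ , x≡c) → ⊥-elim (x≢c ABx x≡c)))
               (λ { (here c≡x) → x≢c ABx (sym c≡x) ; (there ()) })
               (#β-irr c)
               (λ { (here refl) → ¬c#x ABx , ¬x#c ABx ; (there ()) })
               (λ ((_ , AB⊆X) , _) → x , AB⊆X ABx , here refl)
  ⊆trace : ∀ {e} → PairC x e → e ∈ (c ∷ x ∷ [])
  ⊆trace (inj₁ refl) = there (here refl)
  ⊆trace (inj₂ refl) = here refl
  trace⊆ : ∀ {e} → e ∈ (c ∷ x ∷ []) → PairC x e
  trace⊆ (here refl)         = inj₂ refl
  trace⊆ (there (here refl)) = inj₁ refl

¬conf-c : ¬ Conf βγ (_≡ c)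
¬conf-c (t , trace , (c∈t , t⊆c)) with trace-satisfies-bundle βγ trace (c∈t refl) ((id , id) , refl)
... | a , inj₁ refl , a∈t with () ← t⊆c a∈t
... | b , inj₂ refl , b∈t with () ← t⊆c b∈t

lemma11 : ¬ (Σ (GES Ev) λ γ →
    ∀ (X : Pred Ev 0ℓ) → (Reach γ X → Conf βγ X) × (Conf βγ X → Reach γ X))
lemma11 (γ , C≐) = ¬conf-c (proj₁ (C≐ _) (singleton-reachable γ uncaused))
  where
  cause-is : ∀ {x y} → AB x → NecessaryCause γ c y → ¬ ¬ (y ≡ x)
  cause-is ABx cause = ¬¬-map (λ (Py , y≢c) → pairC-≢c Py y≢c)
    (necessaryCause-precedes γ (proj₂ (C≐ _) (pairC-conf ABx)) (inj₂ refl) cause)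
  uncaused : ∀ y → ¬ NecessaryCause γ c y
  uncaused y cause = cause-is (inj₁ refl) cause λ y≡a →
                     cause-is (inj₂ refl) cause λ y≡b → a≢b (trans (sym y≡a) y≡b)
    where
    a≢b : a ≢ b
    a≢b ()
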